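{- Let $\Sigma,\Gamma$ be finite alphabets with at least two letters each and $\mathcal{I}$ the set of injective morphisms $\Sigma^*\to\Gamma^*$. For every infinite word $w\in\Sigma^{\mathbb{N}}$, $\mathrm{ACE}_{\mathcal{I}}(w)\le\mathrm{ACE}'_{\mathcal{I}}(w)$.
   Context: For a nonempty word $v$ and natural number $p$, $v^{p/|v|}$ is the prefix of length $p$ of $vvv\cdots$. The fractional exponent of a nonempty finite word $u$ is $\mathrm{E}(u)=\sup\{r\in\mathbb{Q}\mid\exists v\ne\varepsilon: u=v^r\}$, and $\mathrm{E}_{\mathcal{I}}(u)=\sup\{\mathrm{E}(h(u))\mid h\in\mathcal{I}\}$. $\mathrm{Fact}_n(w)$ is the set of factors of length $n$ of $w$; for sets $S_n$ of reals, $\limsup_{n\to\infty}S_n=\lim_{N\to\infty}\sup\bigcup_{n\ge N}S_n$. For infinite $w$: $\mathrm{ACE}(w)=\limsup_{n\to\infty}\{\mathrm{E}(u)\mid u\in\mathrm{Fact}_n(w)\}$, $\mathrm{ACE}_{\mathcal{I}}(w)=\sup\{\mathrm{ACE}(h(w))\mid h\in\mathcal{I}\}$, and $\mathrm{ACE}'_{\mathcal{I}}(w)=\limsup_{n\to\infty}\{\mathrm{E}_{\mathcal{I}}(u)\mid u\in\mathrm{Fact}_n(w)\}$. -}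

module Defs where

open import Data.Nat using (ℕ; zero; suc; _+_; _≤_)
open import Data.Fin using (Fin)
open import Data.List using (List; []; _∷_; _++_; length; concatMap; concat; replicate; take; map; upTo)
open import Data.Integer using (+_)
open import Data.Rational using (ℚ; _<_; _/_; 0ℚ)
open import Data.Product using (Σ; ∃; _×_; ∃-syntax)
open import Relation.Binary.PropositionalEquality using (_≡_; _≢_)

Word : Set → Set
Word A = List A

InfWord : Set → Set
InfWord A = ℕ → A

-- Extended real numbers are represented by their (strict) lower Dedekind cuts:
-- a predicate "q < x" on rationals q.  This covers +∞ (every q) as well.
Cut : Set₁
Cut = ℚ → Set

_≤ᶜ_ : Cut → Cut → Set
x ≤ᶜ y = ∀ q → x q → y q

Morphism : ℕ → ℕ → Set
Morphism s t = Fin s → Word (Fin t)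

apply : ∀ {s t} → Morphism s t → Word (Fin s) → Word (Fin t)
apply h u = concatMap h u

Injective : ∀ {s t} → Morphism s t → Set
Injective h = ∀ u v → apply h u ≡ apply h v → u ≡ v

-- Fractional powers: u = v^r  with r = |u|/|v|, i.e. v ≠ ε and u is the
-- prefix of length |u| of vvv⋯ (|u| copies of v suffice since |v| ≥ 1).
IsPowerOf : ∀ {A : Set} → Word A → Word A → Set
IsPowerOf u v = (v ≢ []) × (u ≡ take (length u) (concat (replicate (length u) v)))

-- the exponent |u|/|v| (0 if v is empty; that case is excluded by IsPowerOf)
ratio : ∀ {A : Set} → Word A → Word A → ℚ
ratio u []       = 0ℚ
ratio u (x ∷ xs) = (+ length u) / suc (length xs)

E : ∀ {A : Set} → Word A → Cut
E u q = ∃[ v ] (IsPowerOf u v × q < ratio u v)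

E𝓘 : ∀ {s} (t : ℕ) → Word (Fin s) → Cut
E𝓘 t u q = ∃[ h ] (Injective {t = t} h × E (apply h u) q)

Infix : ∀ {A : Set} → Word A → Word A → Set
Infix x y = ∃[ a ] ∃[ b ] (y ≡ a ++ x ++ b)

prefix : ∀ {A : Set} → ℕ → InfWord A → Word A
prefix m w = map w (upTo m)

slice : ∀ {A : Set} → InfWord A → ℕ → ℕ → Word A
slice w i n = map (λ k → w (i + k)) (upTo n)

Fact : ∀ {A : Set} → InfWord A → ℕ → Word A → Set
Fact w n x = ∃[ i ] (x ≡ slice w i n)

-- Fact_n(h(w)): h(w) is the infinite word whose prefixes are the h(w₀⋯w_{m-1})
-- (h injective, hence non-erasing), so its factors of length n are the
-- length-n infixes of the words h(prefix m w).
FactImg : ∀ {s t} → Morphism s t → InfWord (Fin s) → ℕ → Word (Fin t) → Set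
FactImg h w n x = (length x ≡ n) × ∃[ m ] Infix x (apply h (prefix m w))

SupOver : ∀ {B : Set} → (B → Set) → (B → Cut) → Cut
SupOver P f q = ∃[ x ] (P x × f x q)

-- limsup_{n→∞} S_n = lim_N sup ⋃_{n≥N} S_n; q < limsup iff
-- ∃ q' > q, ∀ N, ∃ n ≥ N, q' < sup S_n
LimSup : (ℕ → Cut) → Cut
LimSup a q = ∃[ q' ] (q < q' × (∀ N → ∃[ n ] (N ≤ n × a n q')))

ACEof : ∀ {A : Set} → (ℕ → Word A → Set) → Cut
ACEof Fct = LimSup (λ n → SupOver (Fct n) E)

ACE : ∀ {A : Set} → InfWord A → Cut
ACE w = ACEof (Fact w)

ACE𝓘 : ∀ {s} (t : ℕ) → InfWord (Fin s) → Cut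
ACE𝓘 t w q = ∃[ h ] (Injective {t = t} h × ACEof (FactImg h w) q)

ACE'𝓘 : ∀ {s} (t : ℕ) → InfWord (Fin s) → Cut
ACE'𝓘 t w = LimSup (λ n → SupOver (Fact w n) (E𝓘 t))

{-# OPTIONS --safe #-}
module Submission where

-- Let h be injective and x a long factor of h(w) with E(x) > q′. Each letter image
-- has length at most L, so x = y₀ h(U) y₁ with |y₀|, |y₁| ≤ L for some factor U of w,
-- and a factor of a power of v is a power of a conjugate of v. Hence
-- E(h(U)) ≥ (|x| − 2L)/|v|, which exceeds any q < q′ once |x| is large (if |v| is
-- small the quotient is large anyway), while |U| ≥ (|x| − 2L)/L is unbounded.
-- So E_𝓘(U) > q for factors U of w of unbounded length.

open import Defs
open import Data.Nat
  using (ℕ; zero; suc; _+_; _*_; _∸_; _≤_; _<_; z≤n; s≤s; NonZero; ≢-nonZero⁻¹; >-nonZero⁻¹)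
open import Data.Nat.Properties
open import Data.Nat.Tactic.RingSolver using (solve-∀)
open import Data.Nat.DivMod using (_%_; m<n⇒m%n≡m; [m+n]%n≡m%n; %-distribˡ-+; m%n%n≡m%n; m%n<n)
open import Data.Fin as Fin using (Fin)
open import Data.Maybe using (Maybe; just; nothing)
open import Data.Maybe.Properties using (just-injective)
open import Data.List using (List; []; _∷_; _++_; length; concat; replicate; take; drop; applyUpTo)
open import Data.List.Properties using (length-++; length-take; length-drop; ∷-injective; ++-assoc; ++-identityʳ; map-upTo; length-++-≤ˡ; length-++-≤ʳ)
open import Data.Product using (∃-syntax; _×_; _,_; proj₁; proj₂)
open import Data.Sum using (_⊎_; inj₁; inj₂)
open import Relation.Binary.PropositionalEquality
open import Relation.Nullary using (yes; no)
import Data.Integer as ℤ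
import Data.Integer.Properties as ℤ
import Data.Rational as ℚ
import Data.Rational.Properties as ℚ
import Data.Rational.Unnormalised as ℚᵘ
import Data.Rational.Unnormalised.Properties as ℚᵘ
open import Data.Rational using (ℚ)

private
  variable
    A : Set

_!?_ : List A → ℕ → Maybe A
[]       !? _     = nothing
(x ∷ xs) !? zero  = just x
(x ∷ xs) !? suc i = xs !? i

!?-extensionality : {xs ys : List A} → (∀ i → xs !? i ≡ ys !? i) → xs ≡ ys
!?-extensionality {xs = []}     {[]}     _  = refl
!?-extensionality {xs = []}     {_ ∷ _}  eq with () ← eq 0
!?-extensionality {xs = _ ∷ _}  {[]}     eq with () ← eq 0
!?-extensionality {xs = x ∷ xs} {y ∷ ys} eq =
  cong₂ _∷_ (just-injective (eq 0)) (!?-extensionality (λ i → eq (suc i)))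

!?-++ˡ : ∀ (xs ys : List A) {i} → i < length xs → (xs ++ ys) !? i ≡ xs !? i
!?-++ˡ (x ∷ xs) ys {zero}  _         = refl
!?-++ˡ (x ∷ xs) ys {suc i} (s≤s i<) = !?-++ˡ xs ys i<

!?-++ʳ : ∀ (xs ys : List A) i → (xs ++ ys) !? (length xs + i) ≡ ys !? i
!?-++ʳ []       ys i = refl
!?-++ʳ (x ∷ xs) ys i = !?-++ʳ xs ys i

!?-take : ∀ n (xs : List A) {i} → i < n → take n xs !? i ≡ xs !? i
!?-take (suc n) []       _                = refl
!?-take (suc n) (x ∷ xs) {zero}  _        = refl
!?-take (suc n) (x ∷ xs) {suc i} (s≤s i<) = !?-take n xs i<

!?-drop : ∀ n (xs : List A) i → drop n xs !? i ≡ xs !? (n + i)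
!?-drop zero    xs       i = refl
!?-drop (suc n) []       i = refl
!?-drop (suc n) (x ∷ xs) i = !?-drop n xs i

!?-beyond : ∀ (xs : List A) {i} → length xs ≤ i → xs !? i ≡ nothing
!?-beyond []       _         = refl
!?-beyond (x ∷ xs) (s≤s le) = !?-beyond xs le

repeat : ℕ → List A → List A
repeat k v = concat (replicate k v)

length-repeat : ∀ k (v : List A) → length (repeat k v) ≡ k * length v
length-repeat zero    v = refl
length-repeat (suc k) v = trans (length-++ v) (cong (length v +_) (length-repeat k v))

module Periodic (v : List A) {p : ℕ} .{{_ : NonZero p}} (|v|≡p : length v ≡ p) where

  !?-repeat : ∀ k {i} → i < k * p → repeat k v !? i ≡ v !? (i % p)
  !?-repeat (suc k) {i} i< with i <? p
  ... | yes i<p = begin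
    (v ++ repeat k v) !? i ≡⟨ !?-++ˡ v (repeat k v) (subst (i <_) (sym |v|≡p) i<p) ⟩
    v !? i                 ≡⟨ cong (v !?_) (sym (m<n⇒m%n≡m i<p)) ⟩
    v !? (i % p)           ∎
    where open ≡-Reasoning
  ... | no i≮p = begin
    (v ++ repeat k v) !? i            ≡⟨ cong ((v ++ repeat k v) !?_) (sym p+j≡i) ⟩
    (v ++ repeat k v) !? (p + j)      ≡⟨ cong (λ l → (v ++ repeat k v) !? (l + j)) (sym |v|≡p) ⟩
    (v ++ repeat k v) !? (length v + j) ≡⟨ !?-++ʳ v (repeat k v) j ⟩
    repeat k v !? j                   ≡⟨ !?-repeat k j< ⟩
    v !? (j % p)                      ≡⟨ cong (v !?_) (sym ([m+n]%n≡m%n j p)) ⟩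
    v !? ((j + p) % p)                ≡⟨ cong (λ l → v !? (l % p)) (trans (+-comm j p) p+j≡i) ⟩
    v !? (i % p)                      ∎
    where
    open ≡-Reasoning
    j = i ∸ p
    p+j≡i : p + j ≡ i
    p+j≡i = m+[n∸m]≡n (≮⇒≥ i≮p)
    j< : j < k * p
    j< = +-cancelˡ-< p j (k * p) (subst (_< p + k * p) (sym p+j≡i) i<)

  power⇒!? : ∀ {x} → IsPowerOf x v → ∀ {i} → i < length x → x !? i ≡ v !? (i % p)
  power⇒!? {x} (_ , x≡) {i} i<x = begin
    x !? i                                      ≡⟨ cong (_!? i) x≡ ⟩
    take (length x) (repeat (length x) v) !? i  ≡⟨ !?-take (length x) _ i<x ⟩
    repeat (length x) v !? i                    ≡⟨ !?-repeat (length x) (<-≤-trans i<x (m≤m*n (length x) p)) ⟩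
    v !? (i % p)                                ∎
    where open ≡-Reasoning

  !?⇒power : ∀ {z} → (∀ {i} → i < length z → z !? i ≡ v !? (i % p)) → IsPowerOf z v
  !?⇒power {z} periodic = v≢[] , !?-extensionality pointwise
    where
    v≢[] : v ≢ []
    v≢[] v≡[] = ≢-nonZero⁻¹ p (trans (sym |v|≡p) (cong length v≡[]))
    pointwise : ∀ i → z !? i ≡ take (length z) (repeat (length z) v) !? i
    pointwise i with i <? length z
    ... | yes i<z = begin
      z !? i                                      ≡⟨ periodic i<z ⟩
      v !? (i % p)                                ≡⟨ sym (!?-repeat (length z) (<-≤-trans i<z (m≤m*n (length z) p))) ⟩
      repeat (length z) v !? i                    ≡⟨ sym (!?-take (length z) _ i<z) ⟩
      take (length z) (repeat (length z) v) !? i  ∎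
      where open ≡-Reasoning
    ... | no i≮z = trans (!?-beyond z z≤i) (sym (!?-beyond (take (length z) _) take≤i))
      where
      z≤i : length z ≤ i
      z≤i = ≮⇒≥ i≮z
      take≤i : length (take (length z) (repeat (length z) v)) ≤ i
      take≤i = ≤-trans (≤-reflexive (length-take (length z) _)) (≤-trans (m⊓n≤m (length z) _) z≤i)

  -- The factor of length p of vvv⋯ starting at position r, a conjugate of v.
  rotation : ℕ → List A
  rotation r = take p (drop r (repeat (suc r) v))

  length-rotation : ∀ r → length (rotation r) ≡ p
  length-rotation r = trans (length-take p _) (m≤n⇒m⊓n≡m p≤)
    where
    p≤ : p ≤ length (drop r (repeat (suc r) v))
    p≤ = begin
      p                              ≡⟨ sym (m+n∸n≡m p r) ⟩
      p + r ∸ r                      ≤⟨ ∸-monoˡ-≤ r (+-monoʳ-≤ p (m≤m*n r p)) ⟩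
      p + r * p ∸ r                  ≡⟨ cong (λ l → suc r * l ∸ r) (sym |v|≡p) ⟩
      suc r * length v ∸ r           ≡⟨ cong (_∸ r) (sym (length-repeat (suc r) v)) ⟩
      length (repeat (suc r) v) ∸ r  ≡⟨ sym (length-drop r _) ⟩
      length (drop r (repeat (suc r) v)) ∎
      where open ≤-Reasoning

  !?-rotation : ∀ r {j} → j < p → rotation r !? j ≡ v !? ((r + j) % p)
  !?-rotation r {j} j<p = begin
    rotation r !? j                    ≡⟨ !?-take p _ j<p ⟩
    drop r (repeat (suc r) v) !? j     ≡⟨ !?-drop r _ j ⟩
    repeat (suc r) v !? (r + j)        ≡⟨ !?-repeat (suc r) r+j< ⟩
    v !? ((r + j) % p)                 ∎
    where
    open ≡-Reasoning
    r+j< : r + j < suc r * p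
    r+j< = subst (r + j <_) (+-comm (r * p) p) (+-mono-≤-< (m≤m*n r p) j<p)

infix-of-power : ∀ {v x y₀ z y₁ : List A} {p} .{{_ : NonZero p}} (|v|≡p : length v ≡ p) →
                 IsPowerOf x v → x ≡ y₀ ++ z ++ y₁ → IsPowerOf z (Periodic.rotation v |v|≡p (length y₀))
infix-of-power {v = v} {x} {y₀} {z} {y₁} {p} |v|≡p x-power x≡ = Rot.!?⇒power periodic
  where
  open Periodic v |v|≡p
  r = length y₀
  module Rot = Periodic (rotation r) (length-rotation r)
  r+j<x : ∀ {j} → j < length z → r + j < length x
  r+j<x {j} j<z = begin-strict
    r + j                        <⟨ +-monoʳ-< r (<-≤-trans j<z (m≤m+n (length z) (length y₁))) ⟩
    r + (length z + length y₁)   ≡⟨ cong (r +_) (sym (length-++ z)) ⟩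
    r + length (z ++ y₁)         ≡⟨ sym (length-++ y₀) ⟩
    length (y₀ ++ z ++ y₁)       ≡⟨ cong length (sym x≡) ⟩
    length x                     ∎
    where open ≤-Reasoning
  r+[j%p]≡r+j : ∀ j → (r + j % p) % p ≡ (r + j) % p
  r+[j%p]≡r+j j = begin
    (r + j % p) % p              ≡⟨ %-distribˡ-+ r (j % p) p ⟩
    (r % p + j % p % p) % p      ≡⟨ cong (λ k → (r % p + k) % p) (m%n%n≡m%n j p) ⟩
    (r % p + j % p) % p          ≡⟨ sym (%-distribˡ-+ r j p) ⟩
    (r + j) % p                  ∎
    where open ≡-Reasoning
  periodic : ∀ {j} → j < length z → z !? j ≡ rotation r !? (j % p)
  periodic {j} j<z = begin
    z !? j                       ≡⟨ sym (!?-++ˡ z y₁ j<z) ⟩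
    (z ++ y₁) !? j               ≡⟨ sym (!?-++ʳ y₀ (z ++ y₁) j) ⟩
    (y₀ ++ z ++ y₁) !? (r + j)   ≡⟨ cong (_!? (r + j)) (sym x≡) ⟩
    x !? (r + j)                 ≡⟨ power⇒!? x-power (r+j<x j<z) ⟩
    v !? ((r + j) % p)           ≡⟨ cong (v !?_) (sym (r+[j%p]≡r+j j)) ⟩
    v !? ((r + j % p) % p)       ≡⟨ sym (!?-rotation r (m%n<n j p)) ⟩
    rotation r !? (j % p)        ∎
    where open ≡-Reasoning

private
  rearrange₁ : ∀ c k b d → c * k * b + k + d ≡ (1 + c * b) * k + d
  rearrange₁ = solve-∀
  rearrange₂ : ∀ a d k → a * d * k + d ≡ d * (1 + a * k)
  rearrange₂ = solve-∀
  rearrange₃ : ∀ d m D b → d * ((m + D) * b) ≡ m * d * b + D * d * b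
  rearrange₃ = solve-∀
  rearrange₄ : ∀ c D d b → c * (D * d * b) ≡ c * D * b * d
  rearrange₄ = solve-∀

-- Either k ≥ D·d·b, and the loss D/k is absorbed by the gap between c/d and a/b,
-- or k is bounded and m > c·D·b is large enough on its own.
cross-slack : ∀ a b c d k n m D .{{_ : NonZero b}} .{{_ : NonZero d}} →
              c * b < a * d → a * k < n * b → n ≤ m + D → c * D * b + D < n → c * k < m * d
cross-slack a b c d k n m D c/d<a/b a/b<n/k n≤m+D n-large with D * d * b ≤? k
... | yes large-k = *-cancelʳ-< b (c * k) (m * d) (+-cancelʳ-≤ k (suc (c * k * b)) (m * d * b) chain)
  where
  open ≤-Reasoning
  chain : suc (c * k * b) + k ≤ m * d * b + k
  chain = begin
    suc (c * k * b) + k    ≡⟨ +-comm (c * k * b + k) 1 ⟨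
    c * k * b + k + 1      ≤⟨ +-monoʳ-≤ (c * k * b + k) (>-nonZero⁻¹ d) ⟩
    c * k * b + k + d      ≡⟨ rearrange₁ c k b d ⟩
    (1 + c * b) * k + d    ≤⟨ +-monoˡ-≤ d (*-monoˡ-≤ k c/d<a/b) ⟩
    a * d * k + d          ≡⟨ rearrange₂ a d k ⟩
    d * (1 + a * k)        ≤⟨ *-monoʳ-≤ d a/b<n/k ⟩
    d * (n * b)            ≤⟨ *-monoʳ-≤ d (*-monoˡ-≤ b n≤m+D) ⟩
    d * ((m + D) * b)      ≡⟨ rearrange₃ d m D b ⟩
    m * d * b + D * d * b  ≤⟨ +-monoʳ-≤ (m * d * b) large-k ⟩
    m * d * b + k          ∎
... | no small-k = begin-strict
    c * k             ≤⟨ *-monoʳ-≤ c (<⇒≤ (≰⇒> small-k)) ⟩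
    c * (D * d * b)   ≡⟨ rearrange₄ c D d b ⟩
    c * D * b * d     <⟨ *-monoˡ-< d (+-cancelʳ-≤ D (suc (c * D * b)) m (≤-trans n-large n≤m+D)) ⟩
    m * d             ∎
  where open ≤-Reasoning

private
  pos-*-< : ∀ a b c d → a * b < c * d → ℤ.+ a ℤ.* ℤ.+ b ℤ.< ℤ.+ c ℤ.* ℤ.+ d
  pos-*-< a b c d lt = subst₂ ℤ._<_ (ℤ.pos-* a b) (ℤ.pos-* c d) (ℤ.+<+ lt)

  pos-*-<⁻¹ : ∀ a b c d → ℤ.+ a ℤ.* ℤ.+ b ℤ.< ℤ.+ c ℤ.* ℤ.+ d → a * b < c * d
  pos-*-<⁻¹ a b c d lt = ℤ.drop‿+<+ (subst₂ ℤ._<_ (sym (ℤ.pos-* a b)) (sym (ℤ.pos-* c d)) lt)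

  -- n / suc k is stored in lowest terms; going through ℚᵘ compares with the unreduced fraction.
  <-/⇒ : ∀ q n k → q ℚ.< ℤ.+ n ℚ./ suc k → ℚ.↥ q ℤ.* ℤ.+ suc k ℤ.< ℤ.+ n ℤ.* ℚ.↧ q
  <-/⇒ q@record{} n k lt with ℚᵘ.<-respʳ-≃ (ℚ.toℚᵘ-fromℚᵘ (ℚᵘ.mkℚᵘ (ℤ.+ n) k)) (ℚ.toℚᵘ-mono-< lt)
  ... | ℚᵘ.*<* cross = cross

  ⇒<-/ : ∀ q n k → ℚ.↥ q ℤ.* ℤ.+ suc k ℤ.< ℤ.+ n ℤ.* ℚ.↧ q → q ℚ.< ℤ.+ n ℚ./ suc k
  ⇒<-/ q@record{} n k cross =
    ℚ.toℚᵘ-cancel-< (ℚᵘ.<-respʳ-≃ (ℚᵘ.≃-sym (ℚ.toℚᵘ-fromℚᵘ (ℚᵘ.mkℚᵘ (ℤ.+ n) k))) (ℚᵘ.*<* cross))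

ratio-slack : ∀ {q q′ : ℚ} → q ℚ.< q′ → ∀ D →
              ∃[ N ] (∀ {n m k} → N ≤ n → n ≤ m + D → q′ ℚ.< ℤ.+ n ℚ./ suc k → q ℚ.< ℤ.+ m ℚ./ suc k)
ratio-slack {ℚ.mkℚ ℤ.-[1+ c ] d-1 _} _ _ =
  0 , λ {_} {m} {k} _ _ _ → ⇒<-/ _ m k (subst (ℤ.-[1+ c ] ℤ.* ℤ.+ suc k ℤ.<_) (ℤ.pos-* m (suc d-1)) ℤ.-<+)
ratio-slack {ℚ.mkℚ (ℤ.+ c) d-1 _} {ℚ.mkℚ (ℤ.+ a) b-1 _} (ℚ.*<* q<q′) D =
  suc (c * D * suc b-1 + D) , λ {n} {m} {k} N≤n n≤m+D q′<n/k →
    ⇒<-/ _ m k (pos-*-< c (suc k) m d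
      (cross-slack a b c d (suc k) n m D (pos-*-<⁻¹ c b a d q<q′) (pos-*-<⁻¹ a (suc k) n b (<-/⇒ _ n k q′<n/k)) n≤m+D N≤n))
  where
  b d : ℕ
  b = suc b-1
  d = suc d-1
ratio-slack {ℚ.mkℚ (ℤ.+ c) d-1 _} {ℚ.mkℚ ℤ.-[1+ a ] b-1 _} (ℚ.*<* q<q′) _
  with () ← subst (ℤ._< _) (sym (ℤ.pos-* c (suc b-1))) q<q′

ratio-cong : ∀ (u v v′ : List A) → length v ≡ length v′ → ratio u v ≡ ratio u v′
ratio-cong u []      []      _  = refl
ratio-cong u (_ ∷ _) (_ ∷ _) eq = cong (λ k → ℤ.+ length u ℚ./ suc k) (suc-injective eq)

module _ {q q′ : ℚ} (q<q′ : q ℚ.< q′) (D : ℕ) where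

  threshold : ℕ
  threshold = proj₁ (ratio-slack q<q′ D)

  E-of-core : ∀ {x y₀ z y₁ : List A} → E x q′ → x ≡ y₀ ++ z ++ y₁ →
              threshold ≤ length x → length x ≤ length z + D → E z q
  E-of-core ([] , (v≢[] , _) , _) _ _ _ with () ← v≢[] refl
  E-of-core {x = x} {y₀} {z} {y₁} (v@(e ∷ es) , x-power , q′<x/v) x≡ long short =
    rotation (length y₀) , infix-of-power {y₀ = y₀} {y₁ = y₁} refl x-power x≡ , q<z/rotation
    where
    open Periodic v refl
    q<z/rotation : q ℚ.< ratio z (rotation (length y₀))
    q<z/rotation = subst (q ℚ.<_) (ratio-cong z v (rotation (length y₀)) (sym (length-rotation (length y₀))))
                     (proj₂ (ratio-slack q<q′ D) long short q′<x/v)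

levi : ∀ (x y u v : List A) → x ++ y ≡ u ++ v →
       (∃[ m ] (x ≡ u ++ m × v ≡ m ++ y)) ⊎ (∃[ m ] (u ≡ x ++ m × y ≡ m ++ v))
levi []      y u        v eq = inj₂ (u , refl , eq)
levi (a ∷ x) y []       v eq = inj₁ (a ∷ x , refl , sym eq)
levi (a ∷ x) y (b ∷ u)  v eq with ∷-injective eq
... | a≡b , rest with levi x y u v rest
...   | inj₁ (m , x≡ , v≡) = inj₁ (m , cong₂ _∷_ a≡b x≡ , v≡)
...   | inj₂ (m , u≡ , y≡) = inj₂ (m , cong₂ _∷_ (sym a≡b) u≡ , y≡)

≡++⇒length-≤ˡ : ∀ {x : List A} y m → x ≡ y ++ m → length y ≤ length x
≡++⇒length-≤ˡ y m refl = length-++-≤ˡ y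

≡++⇒length-≤ʳ : ∀ {x : List A} y m → x ≡ m ++ y → length y ≤ length x
≡++⇒length-≤ʳ y m refl = length-++-≤ʳ y {m}

totalImageLength : ∀ {s t} → Morphism s t → ℕ
totalImageLength {zero}  h = 0
totalImageLength {suc s} h = length (h Fin.zero) + totalImageLength (λ c → h (Fin.suc c))

length-image≤total : ∀ {s t} (h : Morphism s t) c → length (h c) ≤ totalImageLength h
length-image≤total {suc s} h Fin.zero    = m≤m+n _ _
length-image≤total {suc s} h (Fin.suc c) = ≤-trans (length-image≤total (λ c → h (Fin.suc c)) c) (m≤n+m _ _)

module Image {s t} (h : Morphism s t) {L : ℕ} (bounded : ∀ c → length (h c) ≤ L) where

  length-apply≤ : ∀ U → length (apply h U) ≤ length U * L
  length-apply≤ []      = z≤n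
  length-apply≤ (c ∷ U) = begin
    length (h c ++ apply h U)          ≡⟨ length-++ (h c) ⟩
    length (h c) + length (apply h U)  ≤⟨ +-mono-≤ (bounded c) (length-apply≤ U) ⟩
    L + length U * L                   ∎
    where open ≤-Reasoning

  image-prefix : ∀ W y b → apply h W ≡ y ++ b →
                 ∃[ W₁ ] ∃[ W₂ ] ∃[ y₁ ] (W ≡ W₁ ++ W₂ × y ≡ apply h W₁ ++ y₁ × length y₁ ≤ L)
  image-prefix []      []      b _  = [] , [] , [] , refl , refl , z≤n
  image-prefix (c ∷ W) y       b eq with levi (h c) (apply h W) y b eq
  ... | inj₁ (m , hc≡ , _) = [] , c ∷ W , y , refl , refl , ≤-trans (≡++⇒length-≤ˡ y m hc≡) (bounded c)
  ... | inj₂ (m , y≡ , hW≡) with image-prefix W m b hW≡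
  ...   | W₁ , W₂ , y₁ , W≡ , m≡ , y₁≤ =
    c ∷ W₁ , W₂ , y₁ , cong (c ∷_) W≡ ,
    trans y≡ (trans (cong (h c ++_) m≡) (sym (++-assoc (h c) (apply h W₁) y₁))) , y₁≤

  record Core (W : Word (Fin s)) (x : Word (Fin t)) : Set where
    field
      before core after : Word (Fin s)
      left right        : Word (Fin t)
      W≡                : W ≡ before ++ core ++ after
      x≡                : x ≡ left ++ apply h core ++ right
      left≤             : length left ≤ L
      right≤            : length right ≤ L

  image-infix : ∀ W a x b → apply h W ≡ a ++ x ++ b → Core W x
  image-infix []      [] [] [] _ = record
    { before = [] ; core = [] ; after = [] ; left = [] ; right = []
    ; W≡ = refl ; x≡ = refl ; left≤ = z≤n ; right≤ = z≤n }
  image-infix (c ∷ W) a x b eq with levi (h c) (apply h W) a (x ++ b) eq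
  ... | inj₂ (m , a≡ , hW≡) =
    let open Core (image-infix W m x b hW≡) in record
      { before = c ∷ before ; core = core ; after = after ; left = left ; right = right
      ; W≡ = cong (c ∷_) W≡ ; x≡ = x≡ ; left≤ = left≤ ; right≤ = right≤ }
  ... | inj₁ (m , hc≡ , x++b≡) with levi x b m (apply h W) x++b≡
  ...   | inj₁ (n , x≡ , hW≡) =
    let W₁ , W₂ , y₁ , W≡ , n≡ , y₁≤ = image-prefix W n b hW≡ in record
      { before = c ∷ [] ; core = W₁ ; after = W₂ ; left = m ; right = y₁
      ; W≡ = cong (c ∷_) W≡ ; x≡ = trans x≡ (cong (m ++_) n≡)
      ; left≤ = ≤-trans (≡++⇒length-≤ʳ m a hc≡) (bounded c) ; right≤ = y₁≤ }
  ...   | inj₂ (n , m≡ , _) = record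
      { before = [] ; core = [] ; after = c ∷ W ; left = x ; right = []
      ; W≡ = refl ; x≡ = sym (++-identityʳ x)
      ; left≤ = ≤-trans (≡++⇒length-≤ˡ x n m≡) (≤-trans (≡++⇒length-≤ʳ m a hc≡) (bounded c)) ; right≤ = z≤n }

applyUpTo-prefix : ∀ (f : ℕ → A) m U B → applyUpTo f m ≡ U ++ B → U ≡ applyUpTo f (length U)
applyUpTo-prefix f m       []      B _  = refl
applyUpTo-prefix f (suc m) (u ∷ U) B eq with f0≡u , rest ← ∷-injective eq =
  cong₂ _∷_ (sym f0≡u) (applyUpTo-prefix (λ k → f (suc k)) m U B rest)

applyUpTo-infix : ∀ (f : ℕ → A) m P U B → applyUpTo f m ≡ P ++ U ++ B →
                  U ≡ applyUpTo (λ k → f (length P + k)) (length U)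
applyUpTo-infix f m       []      U B eq = applyUpTo-prefix f m U B eq
applyUpTo-infix f (suc m) (_ ∷ P) U B eq = applyUpTo-infix (λ k → f (suc k)) m P U B (proj₂ (∷-injective eq))

infix-of-prefix : ∀ (w : InfWord A) m P U B → prefix m w ≡ P ++ U ++ B → Fact w (length U) U
infix-of-prefix w m P U B eq =
  length P , trans (applyUpTo-infix w m P U B (trans (sym (map-upTo w m)) eq)) (sym (map-upTo _ (length U)))

module PullBack {s t} (h : Morphism s t) (w : InfWord (Fin s)) {q q′ : ℚ} (q<q′ : q ℚ.< q′) where

  -- L is taken positive so that N ≤ |U| can be read off from N·L ≤ |U|·L.
  L D : ℕ
  L = suc (totalImageLength h)
  D = L + L

  open Image h (λ c → m≤n⇒m≤1+n (length-image≤total h c))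

  pull-back : ∀ N {n x} → threshold q<q′ D + (N * L + D) ≤ n → FactImg h w n x → E x q′ →
              ∃[ U ] (N ≤ length U × Fact w (length U) U × E (apply h U) q)
  pull-back N {n} {x} n-large (|x|≡n , m , a , b , eq) Ex =
    core , N≤|core| , infix-of-prefix w m before core after W≡ ,
    E-of-core q<q′ D {y₀ = left} {y₁ = right} Ex x≡ (≤-trans (m≤m+n _ _) |x|-large) |x|≤
    where
    open Core (image-infix (prefix m w) a x b eq)
    |x|-large : threshold q<q′ D + (N * L + D) ≤ length x
    |x|-large = ≤-trans n-large (≤-reflexive (sym |x|≡n))
    |x|≤ : length x ≤ length (apply h core) + D
    |x|≤ = begin
      length x                                        ≡⟨ cong length x≡ ⟩
      length (left ++ apply h core ++ right)          ≡⟨ length-++ left ⟩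
      length left + length (apply h core ++ right)    ≡⟨ cong (length left +_) (length-++ (apply h core)) ⟩
      length left + (length (apply h core) + length right) ≤⟨ +-mono-≤ left≤ (+-monoʳ-≤ _ right≤) ⟩
      L + (length (apply h core) + L)                 ≡⟨ +-comm L _ ⟩
      length (apply h core) + L + L                   ≡⟨ +-assoc _ L L ⟩
      length (apply h core) + D                       ∎
      where open ≤-Reasoning
    N≤|core| : N ≤ length core
    N≤|core| = *-cancelʳ-≤ N (length core) L (+-cancelʳ-≤ D (N * L) (length core * L) (begin
      N * L + D                       ≤⟨ m≤n+m (N * L + D) (threshold q<q′ D) ⟩
      threshold q<q′ D + (N * L + D)  ≤⟨ |x|-large ⟩
      length x                        ≤⟨ |x|≤ ⟩
      length (apply h core) + D       ≤⟨ +-monoˡ-≤ D (length-apply≤ core) ⟩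
      length core * L + D             ∎))
      where open ≤-Reasoning

mainTheorem12 : (s t : ℕ) → 2 ≤ s → 2 ≤ t → (w : InfWord (Fin s)) →
    ACE𝓘 t w ≤ᶜ ACE'𝓘 t w
mainTheorem12 s t _ _ w q (h , h-injective , q′ , q<q′ , often) with ℚ.<-dense q<q′
... | q″ , q<q″ , q″<q′ = q″ , q<q″ , frequent
  where
  open PullBack h w q″<q′
  frequent : ∀ N → ∃[ n ] (N ≤ n × SupOver (Fact w n) (E𝓘 t) q″)
  frequent N with often (threshold q″<q′ D + (N * L + D))
  ... | n , n-large , x , x-factor , Ex with pull-back N n-large x-factor Ex
  ...   | U , N≤|U| , U-factor , EhU = length U , N≤|U| , U , U-factor , h , h-injective , EhU
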